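{- Let $T$ be a consistent theory in the language of arithmetic. The following two statements are equivalent. (a) (Weak Diagonal Lemma for $T$) For every formula $\Psi(x)$ with exactly one free variable $x$ there exists a sentence $\theta$ such that the sentence $\Psi(\ulcorner\theta\urcorner)\leftrightarrow\theta$ is consistent with $T$. (b) (Syntactic Tarski's Theorem for $T$) For every formula $\Psi(x)$ with exactly one free variable $x$, $T\nsupseteq{\sf TB}^\Psi$, where ${\sf TB}^\Psi=\{\Psi(\ulcorner\beta\urcorner)\leftrightarrow\beta \mid \beta \text{ is a sentence}\}$; that is, there is some sentence $\beta$ with $T\nvdash\Psi(\ulcorner\beta\urcorner)\leftrightarrow\beta$.
   Context: $\ulcorner\beta\urcorner$ denotes the numeral of the Gödel code of $\beta$ under a fixed suitable Gödel coding. Theories are identified with their (deductively closed) sets of theorems, so $T\supseteq S$ means that $T$ proves every member of $S$. -}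

module Defs where

open import Data.Nat using (ℕ; zero; suc)
open import Data.Fin using (Fin; zero; suc)
open import Data.List using (List; []; _∷_; map)
open import Data.List.Membership.Propositional using (_∈_)
open import Data.List.Relation.Unary.All using (All)
open import Data.Product using (Σ; _×_)
open import Data.Sum using (_⊎_)
open import Relation.Nullary using (¬_)
open import Relation.Binary.PropositionalEquality using (_≡_)

-- Syntax of first-order arithmetic (language 0, S, +, ×, =),
-- de Bruijn variables: Term n / Formula n have free variables among Fin n.

data Term (n : ℕ) : Set where
  var  : Fin n → Term n
  `0   : Term n
  `S   : Term n → Term n
  _`+_ : Term n → Term n → Term n
  _`*_ : Term n → Term n → Term n

infixr 5 _⇒_
data Formula (n : ℕ) : Set where
  ⊥'  : Formula n
  _≐_ : Term n → Term n → Formula n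
  _⇒_ : Formula n → Formula n → Formula n
  ∀'  : Formula (suc n) → Formula n

Sentence : Set
Sentence = Formula 0

¬' : ∀ {n} → Formula n → Formula n
¬' φ = φ ⇒ ⊥'

_∧'_ : ∀ {n} → Formula n → Formula n → Formula n
φ ∧' ψ = ¬' (φ ⇒ ¬' ψ)

_⇔'_ : ∀ {n} → Formula n → Formula n → Formula n
φ ⇔' ψ = (φ ⇒ ψ) ∧' (ψ ⇒ φ)

extR : ∀ {n m} → (Fin n → Fin m) → Fin (suc n) → Fin (suc m)
extR ρ zero    = zero
extR ρ (suc i) = suc (ρ i)

renT : ∀ {n m} → (Fin n → Fin m) → Term n → Term m
renT ρ (var i)  = var (ρ i)
renT ρ `0       = `0
renT ρ (`S t)   = `S (renT ρ t)
renT ρ (s `+ t) = renT ρ s `+ renT ρ t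
renT ρ (s `* t) = renT ρ s `* renT ρ t

ren : ∀ {n m} → (Fin n → Fin m) → Formula n → Formula m
ren ρ ⊥'       = ⊥'
ren ρ (s ≐ t)  = renT ρ s ≐ renT ρ t
ren ρ (φ ⇒ ψ)  = ren ρ φ ⇒ ren ρ ψ
ren ρ (∀' φ)   = ∀' (ren (extR ρ) φ)

weaken : ∀ {n} → Formula n → Formula (suc n)
weaken = ren suc

extS : ∀ {n m} → (Fin n → Term m) → Fin (suc n) → Term (suc m)
extS σ zero    = var zero
extS σ (suc i) = renT suc (σ i)

substT : ∀ {n m} → (Fin n → Term m) → Term n → Term m
substT σ (var i)  = σ i
substT σ `0       = `0
substT σ (`S t)   = `S (substT σ t)
substT σ (s `+ t) = substT σ s `+ substT σ t
substT σ (s `* t) = substT σ s `* substT σ t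

subst : ∀ {n m} → (Fin n → Term m) → Formula n → Formula m
subst σ ⊥'      = ⊥'
subst σ (s ≐ t) = substT σ s ≐ substT σ t
subst σ (φ ⇒ ψ) = subst σ φ ⇒ subst σ ψ
subst σ (∀' φ)  = ∀' (subst (extS σ) φ)

sub0 : ∀ {n} → Term n → Fin (suc n) → Term n
sub0 t zero    = t
sub0 t (suc i) = var i

_[_] : ∀ {n} → Formula (suc n) → Term n → Formula n
φ [ t ] = subst (sub0 t) φ

numeral : ∀ {n} → ℕ → Term n
numeral zero    = `0
numeral (suc k) = `S (numeral k)

data OccursT {n} (i : Fin n) : Term n → Set where
  here : OccursT i (var i)
  S    : ∀ {t} → OccursT i t → OccursT i (`S t)
  +ˡ   : ∀ {s t} → OccursT i s → OccursT i (s `+ t)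
  +ʳ   : ∀ {s t} → OccursT i t → OccursT i (s `+ t)
  *ˡ   : ∀ {s t} → OccursT i s → OccursT i (s `* t)
  *ʳ   : ∀ {s t} → OccursT i t → OccursT i (s `* t)

data Occurs : ∀ {n} → Fin n → Formula n → Set where
  ≐ˡ : ∀ {n} {i : Fin n} {s t} → OccursT i s → Occurs i (s ≐ t)
  ≐ʳ : ∀ {n} {i : Fin n} {s t} → OccursT i t → Occurs i (s ≐ t)
  ⇒ˡ : ∀ {n} {i : Fin n} {φ ψ} → Occurs i φ → Occurs i (φ ⇒ ψ)
  ⇒ʳ : ∀ {n} {i : Fin n} {φ ψ} → Occurs i ψ → Occurs i (φ ⇒ ψ)
  ∀' : ∀ {n} {i : Fin n} {φ} → Occurs (suc i) φ → Occurs i (∀' φ)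

-- formulas with exactly one free variable x (= de Bruijn variable 0)
record Formula¹ : Set where
  constructor mk
  field
    formula : Formula 1
    occurs  : Occurs zero formula
open Formula¹ public

infix 3 _⊢_
data _⊢_ {n : ℕ} (Γ : List (Formula n)) : Formula n → Set where
  hyp   : ∀ {φ} → φ ∈ Γ → Γ ⊢ φ
  ⇒I    : ∀ {φ ψ} → (φ ∷ Γ) ⊢ ψ → Γ ⊢ φ ⇒ ψ
  ⇒E    : ∀ {φ ψ} → Γ ⊢ φ ⇒ ψ → Γ ⊢ φ → Γ ⊢ ψ
  raa   : ∀ {φ} → (¬' φ ∷ Γ) ⊢ ⊥' → Γ ⊢ φ
  ∀I    : ∀ {φ} → map weaken Γ ⊢ φ → Γ ⊢ ∀' φ
  ∀E    : ∀ {φ} → Γ ⊢ ∀' φ → (t : Term n) → Γ ⊢ φ [ t ]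
  ≐refl : ∀ {t} → Γ ⊢ t ≐ t
  ≐sub  : ∀ {φ s t} → Γ ⊢ s ≐ t → Γ ⊢ φ [ s ] → Γ ⊢ φ [ t ]

Theory : Set₁
Theory = Sentence → Set

_⊩_ : Theory → Sentence → Set
T ⊩ φ = Σ (List Sentence) λ Γ → All T Γ × (Γ ⊢ φ)

Consistent : Theory → Set
Consistent T = ¬ (T ⊩ ⊥')

_∪｛_｝ : Theory → Sentence → Theory
(T ∪｛ φ ｝) ψ = T ψ ⊎ ψ ≡ φ

ConsistentWith : Sentence → Theory → Set
ConsistentWith φ T = Consistent (T ∪｛ φ ｝)

TBinst : (Sentence → ℕ) → Formula 1 → Sentence → Sentence
TBinst code Ψ β = (Ψ [ numeral (code β) ]) ⇔' β

WeakDiagonal : (Sentence → ℕ) → Theory → Set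
WeakDiagonal code T =
  (Ψ : Formula¹) → Σ Sentence λ θ → ConsistentWith (TBinst code (formula Ψ) θ) T

SyntacticTarski : (Sentence → ℕ) → Theory → Set
SyntacticTarski code T =
  (Ψ : Formula¹) → Σ Sentence λ β → ¬ (T ⊩ TBinst code (formula Ψ) β)

module Submission where

-- Both directions apply the hypothesis to ¬Ψ.  Classically Ψ(⌜θ⌝) ↔ θ and ¬Ψ(⌜θ⌝) ↔ θ
-- are jointly inconsistent, and ¬(Ψ(⌜θ⌝) ↔ θ) implies ¬Ψ(⌜θ⌝) ↔ θ; so T proves an instance
-- of TB^Ψ exactly when the same instance of TB^¬Ψ is inconsistent with T.

open import Defs
open import Data.Nat using (ℕ)
open import Data.List using (List; []; _∷_; map)
open import Data.List.Relation.Binary.Subset.Propositional using (_⊆_)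
open import Data.List.Relation.Binary.Subset.Propositional.Properties using (map⁺; ∷⁺ʳ; xs⊆x∷xs)
open import Data.List.Relation.Unary.All using (All; []; _∷_)
import Data.List.Relation.Unary.All as All
open import Data.List.Relation.Unary.Any using (here; there)
open import Data.Product using (Σ; _×_; _,_)
open import Data.Sum using (inj₁; inj₂)
open import Function.Bundles using (_⇔_; mk⇔)
open import Function.Definitions using (Injective)
open import Relation.Nullary using (¬_)
open import Relation.Binary.PropositionalEquality using (_≡_; refl)

private
  variable
    n : ℕ
    Γ Δ : List (Formula n)
    φ ψ χ : Formula n

⊢-mono : Γ ⊆ Δ → Γ ⊢ φ → Δ ⊢ φ
⊢-mono Γ⊆Δ (hyp φ∈Γ)  = hyp (Γ⊆Δ φ∈Γ)
⊢-mono Γ⊆Δ (⇒I d)     = ⇒I (⊢-mono (∷⁺ʳ _ Γ⊆Δ) d)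
⊢-mono Γ⊆Δ (⇒E d e)   = ⇒E (⊢-mono Γ⊆Δ d) (⊢-mono Γ⊆Δ e)
⊢-mono Γ⊆Δ (raa d)    = raa (⊢-mono (∷⁺ʳ _ Γ⊆Δ) d)
⊢-mono Γ⊆Δ (∀I d)     = ∀I (⊢-mono (map⁺ weaken Γ⊆Δ) d)
⊢-mono Γ⊆Δ (∀E d t)   = ∀E (⊢-mono Γ⊆Δ d) t
⊢-mono Γ⊆Δ ≐refl      = ≐refl
⊢-mono Γ⊆Δ (≐sub d e) = ≐sub (⊢-mono Γ⊆Δ d) (⊢-mono Γ⊆Δ e)

⊢-weaken : Γ ⊢ φ → (ψ ∷ Γ) ⊢ φ
⊢-weaken = ⊢-mono (xs⊆x∷xs _ _)

⊢-head : (φ ∷ Γ) ⊢ φ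
⊢-head = hyp (here refl)

⊢-efq : Γ ⊢ ⊥' → Γ ⊢ φ
⊢-efq d = raa (⊢-weaken d)

⊢-∧I : Γ ⊢ φ → Γ ⊢ ψ → Γ ⊢ φ ∧' ψ
⊢-∧I d e = ⇒I (⇒E (⇒E ⊢-head (⊢-weaken d)) (⊢-weaken e))

⊢-∧E₁ : Γ ⊢ φ ∧' ψ → Γ ⊢ φ
⊢-∧E₁ d = raa (⇒E (⊢-weaken d) (⇒I (⇒I (⇒E (⊢-weaken (⊢-weaken ⊢-head)) (⊢-weaken ⊢-head)))))

⊢-∧E₂ : Γ ⊢ φ ∧' ψ → Γ ⊢ ψ
⊢-∧E₂ d = raa (⇒E (⊢-weaken d) (⇒I (⊢-weaken ⊢-head)))

⇔∧¬⇔⇒⊥ : Γ ⊢ φ ⇔' χ → Γ ⊢ ¬' φ ⇔' χ → Γ ⊢ ⊥'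
⇔∧¬⇔⇒⊥ {Γ = Γ} {φ = φ} φ⇔χ ¬φ⇔χ = ⇒E ¬φ (⇒E (⊢-∧E₂ φ⇔χ) (⇒E (⊢-∧E₁ ¬φ⇔χ) ¬φ))
  where
  ¬φ : Γ ⊢ ¬' φ
  ¬φ = ⇒I (⇒E (⇒E (⊢-weaken (⊢-∧E₂ ¬φ⇔χ)) (⇒E (⊢-weaken (⊢-∧E₁ φ⇔χ)) ⊢-head)) ⊢-head)

⇔⇒¬[¬⇔] : Γ ⊢ φ ⇔' χ → Γ ⊢ ¬' (¬' φ ⇔' χ)
⇔⇒¬[¬⇔] φ⇔χ = ⇒I (⇔∧¬⇔⇒⊥ (⊢-weaken φ⇔χ) ⊢-head)

¬[⇔]⇒¬⇔ : Γ ⊢ ¬' (φ ⇔' χ) → Γ ⊢ ¬' φ ⇔' χ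
¬[⇔]⇒¬⇔ ¬[φ⇔χ] = ⊢-∧I
  (⇒I (raa (⇒E (⊢-weaken (⊢-weaken ¬[φ⇔χ]))
    (⊢-∧I (⇒I (⊢-efq (⇒E (⊢-weaken (⊢-weaken ⊢-head)) ⊢-head)))
          (⇒I (⊢-efq (⇒E (⊢-weaken ⊢-head) ⊢-head)))))))
  (⇒I (⇒I (⇒E (⊢-weaken (⊢-weaken ¬[φ⇔χ]))
    (⊢-∧I (⇒I (⊢-weaken (⊢-weaken ⊢-head))) (⇒I (⊢-weaken ⊢-head))))))

⊩-map : ∀ {T} {φ ψ : Sentence} → (∀ {Γ} → Γ ⊢ φ → Γ ⊢ ψ) → T ⊩ φ → T ⊩ ψ
⊩-map f (Γ , Γ∈T , d) = Γ , Γ∈T , f d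

⊩¬⇒¬ConsistentWith : ∀ {T} {φ : Sentence} → T ⊩ ¬' φ → ¬ ConsistentWith φ T
⊩¬⇒¬ConsistentWith (Γ , Γ∈T , d) con =
  con (_ ∷ Γ , inj₂ refl ∷ All.map inj₁ Γ∈T , ⇒E (⊢-weaken d) ⊢-head)

split-axiom : ∀ {T} {φ : Sentence} (Γ : List Sentence) → All (T ∪｛ φ ｝) Γ →
  Σ (List Sentence) λ Δ → All T Δ × (Γ ⊆ φ ∷ Δ)
split-axiom [] [] = [] , [] , λ ()
split-axiom (ψ ∷ Γ) (inj₁ ψ∈T ∷ Γ∈T∪φ) with split-axiom Γ Γ∈T∪φ
... | Δ , Δ∈T , Γ⊆φ∷Δ = ψ ∷ Δ , ψ∈T ∷ Δ∈T , ψ∷Γ⊆φ∷ψ∷Δ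
  where
  ψ∷Γ⊆φ∷ψ∷Δ : ψ ∷ Γ ⊆ _ ∷ ψ ∷ Δ
  ψ∷Γ⊆φ∷ψ∷Δ (here eq) = there (here eq)
  ψ∷Γ⊆φ∷ψ∷Δ (there χ∈Γ) with Γ⊆φ∷Δ χ∈Γ
  ... | here eq   = here eq
  ... | there χ∈Δ = there (there χ∈Δ)
split-axiom (ψ ∷ Γ) (inj₂ refl ∷ Γ∈T∪φ) with split-axiom Γ Γ∈T∪φ
... | Δ , Δ∈T , Γ⊆φ∷Δ = Δ , Δ∈T , ψ∷Γ⊆ψ∷Δ
  where
  ψ∷Γ⊆ψ∷Δ : ψ ∷ Γ ⊆ ψ ∷ Δ
  ψ∷Γ⊆ψ∷Δ (here eq)   = here eq
  ψ∷Γ⊆ψ∷Δ (there χ∈Γ) = Γ⊆φ∷Δ χ∈Γ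

⊩-deduction : ∀ {T} {φ ψ : Sentence} → (T ∪｛ φ ｝) ⊩ ψ → T ⊩ (φ ⇒ ψ)
⊩-deduction (Γ , Γ∈T∪φ , d) with split-axiom Γ Γ∈T∪φ
... | Δ , Δ∈T , Γ⊆φ∷Δ = Δ , Δ∈T , ⇒I (⊢-mono Γ⊆φ∷Δ d)

¬¹ : Formula¹ → Formula¹
¬¹ Ψ = mk (¬' (formula Ψ)) (⇒ˡ (occurs Ψ))

theorem3p3 : (code : Sentence → ℕ) → Injective _≡_ _≡_ code →
    (T : Theory) → Consistent T →
    (WeakDiagonal code T ⇔ SyntacticTarski code T)
theorem3p3 code _ T _ = mk⇔ weakDiagonal⇒syntacticTarski syntacticTarski⇒weakDiagonal
  where
  weakDiagonal⇒syntacticTarski : WeakDiagonal code T → SyntacticTarski code T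
  weakDiagonal⇒syntacticTarski wd Ψ with wd (¬¹ Ψ)
  ... | θ , consistent = θ , λ T⊢TB → ⊩¬⇒¬ConsistentWith (⊩-map ⇔⇒¬[¬⇔] T⊢TB) consistent

  syntacticTarski⇒weakDiagonal : SyntacticTarski code T → WeakDiagonal code T
  syntacticTarski⇒weakDiagonal st Ψ with st (¬¹ Ψ)
  ... | β , T⊬TB = β , λ inconsistent → T⊬TB (⊩-map ¬[⇔]⇒¬⇔ (⊩-deduction inconsistent))
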